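{- Let $n\ge 3$ and $k=\lceil\log_2 n\rceil$. Then $\det'(Q_n)=k$ if $2^{k-1}<n\le 2^{k-1}+k$, and $\det'(Q_n)=k+1$ if $2^{k-1}+k<n\le 2^k$.
   Context: $Q_n$ is the $n$-dimensional hypercube: its vertices are the binary strings of length $n$, two being adjacent iff they differ in exactly one bit. For a graph with at most one isolated vertex and no $K_2$ component, an edge set $T$ is an edge determining set if the only automorphism $\phi$ with $\{\phi(u),\phi(v)\}=\{u,v\}$ for all $\{u,v\}\in T$ is the identity; $\det'(G)$ is the minimum size of such a set. -}

module Defs where

open import Data.Nat using (ℕ; zero; suc; _+_; _≤_)
open import Data.Bool using (Bool; true; false)
open import Data.Vec using (Vec; []; _∷_)
open import Data.List using (List; length)
open import Data.List.Relation.Unary.All using (All)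
open import Data.Product using (_×_; Σ; _,_)
open import Data.Sum using (_⊎_)
open import Function.Bundles using (_↔_; Inverse)
open import Relation.Binary.PropositionalEquality using (_≡_)

Vertex : ℕ → Set
Vertex n = Vec Bool n

hamming : ∀ {n} → Vertex n → Vertex n → ℕ
hamming [] [] = 0
hamming (true ∷ xs) (true ∷ ys) = hamming xs ys
hamming (false ∷ xs) (false ∷ ys) = hamming xs ys
hamming (true ∷ xs) (false ∷ ys) = suc (hamming xs ys)
hamming (false ∷ xs) (true ∷ ys) = suc (hamming xs ys)

Adj : ∀ {n} → Vertex n → Vertex n → Set
Adj u v = hamming u v ≡ 1

record Aut (n : ℕ) : Set where
  field
    bij : Vertex n ↔ Vertex n
  φ : Vertex n → Vertex n
  φ = Inverse.to bij
  field
    preserves : ∀ u v → (Adj u v → Adj (φ u) (φ v)) × (Adj (φ u) (φ v) → Adj u v)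

-- An edge {u,v} of Q_n, represented by an ordered pair of adjacent vertices.
Edge : ℕ → Set
Edge n = Σ (Vertex n × Vertex n) λ { (u , v) → Adj u v }

FixesEdge : ∀ {n} → Aut n → Edge n → Set
FixesEdge σ ((u , v) , _) =
  (φ u ≡ u × φ v ≡ v) ⊎ (φ u ≡ v × φ v ≡ u)
  where open Aut σ

EdgeDetermining : ∀ {n} → List (Edge n) → Set
EdgeDetermining {n} T = (σ : Aut n) → All (FixesEdge σ) T → ∀ x → Aut.φ σ x ≡ x

-- det'(Q_n) = m : some edge determining set has size m, and every edge
-- determining set has size at least m.  (Edge sets are given as lists;
-- duplicates only increase the length, so the minimum over lists equals
-- the minimum over sets.)
DetPrime≡ : ℕ → ℕ → Set
DetPrime≡ n m =
  (Σ (List (Edge n)) λ T → EdgeDetermining T × length T ≡ m)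
  × (∀ (T : List (Edge n)) → EdgeDetermining T → m ≤ length T)

-- Every automorphism of Q_n is x ↦ s ⊕ (x with coordinates permuted by π). If it fixes an edge
-- {u, u + e_d} setwise then π d = d, and u_{π i} = s_{π i} ⊕ u_i whenever π i ≠ d. Call coordinates
-- c, c′ twins in an edge set T if the columns c and c′ of the source vertices of T are equal or
-- complementary. Then T is determining when its edges are not all parallel and no two distinct
-- non-direction coordinates are twins; conversely twins c, c′ are exchanged (and complemented) by a
-- nontrivial automorphism fixing T. A set of m edges has at most m directions and, normalising
-- columns by their first entry, 2^(m-1) twin classes, so by pigeonhole it determines Q_n only if
-- n ≤ m + 2^(m-1); binary codes give a determining set of m edges whenever 2 ≤ m ≤ n ≤ m + 2^(m-1).
-- Hence det′(Q_n) is the least m with n ≤ m + 2^(m-1), which is ⌈log₂ n⌉ or ⌈log₂ n⌉ + 1.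
module Submission where

open import Defs
open import Data.Nat using (ℕ; zero; suc; s≤s; z≤n; _+_; _∸_; _^_; _≤_; _<_; _≤?_)
open import Data.Nat.Properties
  using (suc-injective; +-comm; +-identityʳ; +-mono-≤; +-monoʳ-<; m≤m+n; m≤n+m; m+n∸n≡m; ≤-refl; ≤-reflexive;
         ≤-trans; ≤-<-trans; <⇒≤; ≰⇒>; pred-mono-≤; ∸-monoˡ-≤; ^-monoʳ-≤; m^n>0)
open import Data.Nat.Logarithm using (⌈log₂_⌉; ⌈log₂⌉-mono-≤)
open import Data.Bool using (Bool; true; false; not; _xor_)
open import Data.Bool.Properties using (not-involutive; not-injective; not-¬; not-distribʳ-xor; xor-identityʳ; xor-same)
open import Data.Fin using (Fin; zero; suc; _≟_; toℕ; inject≤; _↑ˡ_; combine; funToFin; finToFun; join; splitAt)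
open import Data.Fin.Properties
  using (2↔Bool; finToFun-funToFin; funToFin-finToFin; splitAt-join; join-splitAt; splitAt-↑ˡ; pigeonhole; <⇒≢;
         toℕ-injective; toℕ-inject≤; toℕ-↑ˡ; inject≤-injective)
open import Data.Fin.Permutation as Permutation using (Permutation′; _⟨$⟩ʳ_; _⟨$⟩ˡ_; inverseˡ; inverseʳ; transpose)
open import Data.Vec using (Vec; []; _∷_; lookup; updateAt; replicate; tabulate; _[_]≔_)
open import Data.Vec.Properties
  using (lookup∘updateAt; lookup∘updateAt′; lookup∘update; lookup∘update′; lookup∘tabulate; lookup-replicate;
         updateAt-updateAt; updateAt-cong; updateAt-id; updateAt-commutes; tabulate∘lookup; tabulate-cong)
open import Data.List as List using (List; []; _∷_; length)
open import Data.List.Properties using (length-tabulate)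
open import Data.List.Relation.Unary.All as All using (All; []; _∷_)
open import Data.List.Relation.Unary.All.Properties as All using (¬Any⇒All¬)
open import Data.List.Relation.Unary.Any as Any using (Any; any?)
open import Data.List.Relation.Unary.Any.Properties as Any using (lookup-index)
open import Data.Product using (Σ; _×_; _,_; proj₁; proj₂)
open import Data.Sum using (_⊎_; inj₁; inj₂; [_,_]′)
open import Data.Sum.Properties using (inj₁-injective; inj₂-injective)
open import Function using (_∘_; case_of_)
open import Function.Bundles using (Inverse; Injection; mk↔ₛ′)
open import Function.Construct.Symmetry using (↔-sym)
open import Function.Properties.Inverse using (↔⇒↣)
open import Relation.Nullary using (¬_; Dec; yes; no; contradiction)
open import Relation.Nullary.Decidable using (dec-true; dec-false)
open import Relation.Binary.PropositionalEquality

xor-cancelˡ : ∀ b c → b xor (b xor c) ≡ c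
xor-cancelˡ true c = not-involutive c
xor-cancelˡ false c = refl

≡xor⇒false : ∀ a {b} → b ≡ a xor b → a ≡ false
≡xor⇒false false _ = refl
≡xor⇒false true b≡not-b = contradiction b≡not-b (not-¬ refl)

xor-≡⇒≡xor : ∀ x y {p q} → x xor p ≡ y xor q → p ≡ (x xor y) xor q
xor-≡⇒≡xor false false p≡q = p≡q
xor-≡⇒≡xor false true p≡not-q = p≡not-q
xor-≡⇒≡xor true false not-p≡q = trans (sym (not-involutive _)) (cong not not-p≡q)
xor-≡⇒≡xor true true not-p≡not-q = not-injective not-p≡not-q

All-from-lookup : ∀ {A : Set} {P : A → Set} (xs : List A) → (∀ i → P (List.lookup xs i)) → All P xs
All-from-lookup [] _ = []
All-from-lookup (x ∷ xs) P[xs] = P[xs] zero ∷ All-from-lookup xs (P[xs] ∘ suc)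

fromBits : ∀ {k} → (Fin k → Bool) → Fin (2 ^ k)
fromBits f = funToFin (Inverse.from 2↔Bool ∘ f)

toBits : ∀ {k} → Fin (2 ^ k) → Fin k → Bool
toBits x = Inverse.to 2↔Bool ∘ finToFun x

fromBits-injective : ∀ {k} {f g : Fin k → Bool} → fromBits f ≡ fromBits g → ∀ i → f i ≡ g i
fromBits-injective {f = f} {g} eq i = Injection.injective (↔⇒↣ (↔-sym 2↔Bool)) (begin
  Inverse.from 2↔Bool (f i) ≡⟨ finToFun-funToFin (Inverse.from 2↔Bool ∘ f) i ⟨
  finToFun (fromBits f) i   ≡⟨ cong (λ x → finToFun x i) eq ⟩
  finToFun (fromBits g) i   ≡⟨ finToFun-funToFin (Inverse.from 2↔Bool ∘ g) i ⟩
  Inverse.from 2↔Bool (g i) ∎)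
  where open ≡-Reasoning

funToFin-cong : ∀ {m k} {f g : Fin m → Fin k} → (∀ i → f i ≡ g i) → funToFin f ≡ funToFin g
funToFin-cong {zero} _ = refl
funToFin-cong {suc m} f≗g = cong₂ combine (f≗g zero) (funToFin-cong (f≗g ∘ suc))

toBits-injective : ∀ {k} {x y : Fin (2 ^ k)} → (∀ i → toBits {k} x i ≡ toBits y i) → x ≡ y
toBits-injective {k} {x} {y} x≗y = begin
  x                                 ≡⟨ funToFin-finToFin {k} {2} x ⟨
  funToFin {k} (finToFun {2} {k} x) ≡⟨ funToFin-cong {k} (Injection.injective (↔⇒↣ 2↔Bool) ∘ x≗y) ⟩
  funToFin {k} (finToFun {2} {k} y) ≡⟨ funToFin-finToFin {k} {2} y ⟩
  y                                 ∎
  where open ≡-Reasoning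

lookup-ext : ∀ {A : Set} {n} {x y : Vec A n} → (∀ t → lookup x t ≡ lookup y t) → x ≡ y
lookup-ext {x = x} {y} x≗y = begin
  x                   ≡⟨ tabulate∘lookup x ⟨
  tabulate (lookup x) ≡⟨ tabulate-cong x≗y ⟩
  tabulate (lookup y) ≡⟨ tabulate∘lookup y ⟩
  y                   ∎
  where open ≡-Reasoning

flipAt : ∀ {n} → Fin n → Vertex n → Vertex n
flipAt d x = updateAt x d not

zeros : ∀ n → Vertex n
zeros n = replicate n false

lookup-flipAt-≡ : ∀ {n} (d : Fin n) x → lookup (flipAt d x) d ≡ not (lookup x d)
lookup-flipAt-≡ d x = lookup∘updateAt d x

lookup-flipAt-≢ : ∀ {n} {d t : Fin n} x → d ≢ t → lookup (flipAt d x) t ≡ lookup x t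
lookup-flipAt-≢ {d = d} {t} x d≢t = lookup∘updateAt′ t d (d≢t ∘ sym) x

flipAt-involutive : ∀ {n} (d : Fin n) x → flipAt d (flipAt d x) ≡ x
flipAt-involutive d x = begin
  updateAt (updateAt x d not) d not ≡⟨ updateAt-updateAt d x ⟩
  updateAt x d (not ∘ not)          ≡⟨ updateAt-cong d not-involutive x ⟩
  updateAt x d (λ b → b)            ≡⟨ updateAt-id d x ⟩
  x                                 ∎
  where open ≡-Reasoning

flipAt-comm : ∀ {n} (d e : Fin n) x → flipAt d (flipAt e x) ≡ flipAt e (flipAt d x)
flipAt-comm d e x with d ≟ e
... | yes refl = refl
... | no d≢e = updateAt-commutes d e d≢e x

flipAt-injectiveˡ : ∀ {n} {d e : Fin n} x → flipAt d x ≡ flipAt e x → d ≡ e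
flipAt-injectiveˡ {d = d} {e} x eq with e ≟ d
... | yes e≡d = sym e≡d
... | no e≢d = contradiction x[d]≡not-x[d] (not-¬ refl)
  where
  x[d]≡not-x[d] : lookup x d ≡ not (lookup x d)
  x[d]≡not-x[d] = begin
    lookup x d             ≡⟨ lookup-flipAt-≢ x e≢d ⟨
    lookup (flipAt e x) d  ≡⟨ cong (λ y → lookup y d) eq ⟨
    lookup (flipAt d x) d  ≡⟨ lookup-flipAt-≡ d x ⟩
    not (lookup x d)       ∎
    where open ≡-Reasoning

hamming-refl : ∀ {n} (x : Vertex n) → hamming x x ≡ 0
hamming-refl [] = refl
hamming-refl (true ∷ x) = hamming-refl x
hamming-refl (false ∷ x) = hamming-refl x

hamming≡0⇒≡ : ∀ {n} (x y : Vertex n) → hamming x y ≡ 0 → x ≡ y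
hamming≡0⇒≡ [] [] _ = refl
hamming≡0⇒≡ (true ∷ x) (true ∷ y) h = cong (true ∷_) (hamming≡0⇒≡ x y h)
hamming≡0⇒≡ (false ∷ x) (false ∷ y) h = cong (false ∷_) (hamming≡0⇒≡ x y h)

adj-flipAt : ∀ {n} (d : Fin n) x → Adj x (flipAt d x)
adj-flipAt zero (true ∷ x) = cong suc (hamming-refl x)
adj-flipAt zero (false ∷ x) = cong suc (hamming-refl x)
adj-flipAt (suc d) (true ∷ x) = adj-flipAt d x
adj-flipAt (suc d) (false ∷ x) = adj-flipAt d x

adj⇒flipAt : ∀ {n} (x y : Vertex n) → Adj x y → Σ (Fin n) λ d → y ≡ flipAt d x
adj⇒flipAt [] [] ()
adj⇒flipAt (true ∷ x) (true ∷ y) h = let d , y≡ = adj⇒flipAt x y h in suc d , cong (true ∷_) y≡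
adj⇒flipAt (false ∷ x) (false ∷ y) h = let d , y≡ = adj⇒flipAt x y h in suc d , cong (false ∷_) y≡
adj⇒flipAt (true ∷ x) (false ∷ y) h = zero , cong (false ∷_) (sym (hamming≡0⇒≡ x y (suc-injective h)))
adj⇒flipAt (false ∷ x) (true ∷ y) h = zero , cong (true ∷_) (sym (hamming≡0⇒≡ x y (suc-injective h)))

flip-induction : ∀ {n} (P : Vertex n → Set) → P (zeros n) → (∀ d x → P x → P (flipAt d x)) → ∀ x → P x
flip-induction P P0 step [] = P0
flip-induction P P0 step (b ∷ x) = by-head b
  where
  P-false∷ : ∀ x → P (false ∷ x)
  P-false∷ = flip-induction (P ∘ (false ∷_)) P0 (λ d x → step (suc d) (false ∷ x))
  by-head : ∀ b → P (b ∷ x)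
  by-head false = P-false∷ x
  by-head true = step zero (false ∷ x) (P-false∷ x)

common-neighbours : ∀ {n} {α β : Fin n} {w y : Vertex n} → α ≢ β →
                    Adj (flipAt α w) y → Adj (flipAt β w) y → y ≡ w ⊎ y ≡ flipAt α (flipAt β w)
common-neighbours {α = α} {β} {w} {y} α≢β adjα adjβ
  with adj⇒flipAt _ _ adjα | adj⇒flipAt _ _ adjβ
... | γ , y≡γαw | γ′ , y≡γ′βw with γ ≟ α
...   | yes refl = inj₁ (trans y≡γαw (flipAt-involutive γ w))
...   | no γ≢α = inj₂ (trans y≡γ′βw (cong (λ δ → flipAt δ (flipAt β w)) γ′≡α))
  where
  γ′≡α : γ′ ≡ α
  γ′≡α with γ′ ≟ α
  ... | yes γ′≡α = γ′≡α
  ... | no γ′≢α = contradiction (trans (sym y[α]-via-β) y[α]-via-α) (not-¬ refl)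
    where
    open ≡-Reasoning
    y[α]-via-α : lookup y α ≡ not (lookup w α)
    y[α]-via-α = begin
      lookup y α                         ≡⟨ cong (λ z → lookup z α) y≡γαw ⟩
      lookup (flipAt γ (flipAt α w)) α   ≡⟨ lookup-flipAt-≢ (flipAt α w) γ≢α ⟩
      lookup (flipAt α w) α              ≡⟨ lookup-flipAt-≡ α w ⟩
      not (lookup w α)                   ∎
    y[α]-via-β : lookup y α ≡ lookup w α
    y[α]-via-β = begin
      lookup y α                         ≡⟨ cong (λ z → lookup z α) y≡γ′βw ⟩
      lookup (flipAt γ′ (flipAt β w)) α  ≡⟨ lookup-flipAt-≢ (flipAt β w) γ′≢α ⟩
      lookup (flipAt β w) α              ≡⟨ lookup-flipAt-≢ w (α≢β ∘ sym) ⟩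
      lookup w α                         ∎

source target : ∀ {n} → Edge n → Vertex n
source ((u , _) , _) = u
target ((_ , v) , _) = v

direction : ∀ {n} → Edge n → Fin n
direction ((u , v) , u~v) = proj₁ (adj⇒flipAt u v u~v)

target≡flipAt : ∀ {n} (e : Edge n) → target e ≡ flipAt (direction e) (source e)
target≡flipAt ((u , v) , u~v) = proj₂ (adj⇒flipAt u v u~v)

edgeAt : ∀ {n} → Vertex n → Fin n → Edge n
edgeAt u d = (u , flipAt d u) , adj-flipAt d u

target-off-direction : ∀ {n} (e : Edge n) {t} → direction e ≢ t → lookup (target e) t ≡ lookup (source e) t
target-off-direction e {t} d≢t = trans (cong (λ z → lookup z t) (target≡flipAt e)) (lookup-flipAt-≢ (source e) d≢t)

direction-edgeAt : ∀ {n} (u : Vertex n) d → direction (edgeAt u d) ≡ d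
direction-edgeAt u d = sym (flipAt-injectiveˡ u (target≡flipAt (edgeAt u d)))

relabel : ∀ {n} → (Fin n → Bool) → (Fin n → Fin n) → Vertex n → Vertex n
relabel mask f x = tabulate (λ t → mask t xor lookup x (f t))

lookup-relabel : ∀ {n} mask (f : Fin n → Fin n) x t → lookup (relabel mask f x) t ≡ mask t xor lookup x (f t)
lookup-relabel mask f x t = lookup∘tabulate _ t

relabel-flipAt : ∀ {n} mask {f : Fin n → Fin n} → (∀ {s t} → f s ≡ f t → s ≡ t) →
                 ∀ {d d′} → f d′ ≡ d → ∀ x → relabel mask f (flipAt d x) ≡ flipAt d′ (relabel mask f x)
relabel-flipAt mask {f} f-inj {d} {d′} fd′≡d x = lookup-ext pointwise
  where
  open ≡-Reasoning
  pointwise : ∀ t → lookup (relabel mask f (flipAt d x)) t ≡ lookup (flipAt d′ (relabel mask f x)) t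
  pointwise t with t ≟ d′
  ... | yes refl = begin
    lookup (relabel mask f (flipAt d x)) d′  ≡⟨ lookup-relabel mask f (flipAt d x) d′ ⟩
    mask d′ xor lookup (flipAt d x) (f d′)   ≡⟨ cong (λ c → mask d′ xor lookup (flipAt d x) c) fd′≡d ⟩
    mask d′ xor lookup (flipAt d x) d        ≡⟨ cong (mask d′ xor_) (lookup-flipAt-≡ d x) ⟩
    mask d′ xor not (lookup x d)             ≡⟨ not-distribʳ-xor (mask d′) _ ⟨
    not (mask d′ xor lookup x d)             ≡⟨ cong (λ c → not (mask d′ xor lookup x c)) fd′≡d ⟨
    not (mask d′ xor lookup x (f d′))        ≡⟨ cong not (lookup-relabel mask f x d′) ⟨
    not (lookup (relabel mask f x) d′)       ≡⟨ lookup-flipAt-≡ d′ (relabel mask f x) ⟨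
    lookup (flipAt d′ (relabel mask f x)) d′ ∎
  ... | no t≢d′ = begin
    lookup (relabel mask f (flipAt d x)) t  ≡⟨ lookup-relabel mask f (flipAt d x) t ⟩
    mask t xor lookup (flipAt d x) (f t)    ≡⟨ cong (mask t xor_) (lookup-flipAt-≢ x d≢ft) ⟩
    mask t xor lookup x (f t)               ≡⟨ lookup-relabel mask f x t ⟨
    lookup (relabel mask f x) t             ≡⟨ lookup-flipAt-≢ (relabel mask f x) (t≢d′ ∘ sym) ⟨
    lookup (flipAt d′ (relabel mask f x)) t ∎
    where
    d≢ft : d ≢ f t
    d≢ft d≡ft = t≢d′ (f-inj (trans (sym d≡ft) (sym fd′≡d)))

relabel-adj : ∀ {n} mask (ρ : Permutation′ n) {x y} → Adj x y →
              Adj (relabel mask (ρ ⟨$⟩ʳ_) x) (relabel mask (ρ ⟨$⟩ʳ_) y)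
relabel-adj mask ρ {x} x~y with adj⇒flipAt x _ x~y
... | d , refl = subst (Adj (relabel mask (ρ ⟨$⟩ʳ_) x))
                   (sym (relabel-flipAt mask (Injection.injective (↔⇒↣ ρ)) (inverseʳ ρ) x))
                   (adj-flipAt (ρ ⟨$⟩ˡ d) (relabel mask (ρ ⟨$⟩ʳ_) x))

module _ {n} (ρ : Permutation′ n) (mask : Fin n → Bool) where
  private
    ρʳ ρˡ : Fin n → Fin n
    ρʳ = ρ ⟨$⟩ʳ_
    ρˡ = ρ ⟨$⟩ˡ_

    to from : Vertex n → Vertex n
    to = relabel mask ρʳ
    from = relabel (mask ∘ ρˡ) ρˡ

    from∘to : ∀ x → from (to x) ≡ x
    from∘to x = lookup-ext λ t → begin
      lookup (from (to x)) t                                 ≡⟨ lookup-relabel (mask ∘ ρˡ) ρˡ (to x) t ⟩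
      mask (ρˡ t) xor lookup (to x) (ρˡ t)                   ≡⟨ cong (mask (ρˡ t) xor_) (lookup-relabel mask ρʳ x (ρˡ t)) ⟩
      mask (ρˡ t) xor (mask (ρˡ t) xor lookup x (ρʳ (ρˡ t))) ≡⟨ xor-cancelˡ (mask (ρˡ t)) _ ⟩
      lookup x (ρʳ (ρˡ t))                                   ≡⟨ cong (lookup x) (inverseʳ ρ) ⟩
      lookup x t                                             ∎
      where open ≡-Reasoning

    to∘from : ∀ y → to (from y) ≡ y
    to∘from y = lookup-ext λ t → begin
      lookup (to (from y)) t                                 ≡⟨ lookup-relabel mask ρʳ (from y) t ⟩
      mask t xor lookup (from y) (ρʳ t)                      ≡⟨ cong (mask t xor_) (lookup-relabel (mask ∘ ρˡ) ρˡ y (ρʳ t)) ⟩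
      mask t xor (mask (ρˡ (ρʳ t)) xor lookup y (ρˡ (ρʳ t))) ≡⟨ cong (λ s → mask t xor (mask s xor lookup y s)) (inverseˡ ρ) ⟩
      mask t xor (mask t xor lookup y t)                     ≡⟨ xor-cancelˡ (mask t) _ ⟩
      lookup y t                                             ∎
      where open ≡-Reasoning

  relabelAut : Aut n
  relabelAut = record
    { bij = mk↔ₛ′ to from to∘from from∘to
    ; preserves = λ u v → relabel-adj mask ρ {u} {v}
                        , λ tu~tv → subst₂ Adj (from∘to u) (from∘to v)
                                      (relabel-adj (mask ∘ ρˡ) (Permutation.flip ρ) {to u} {to v} tu~tv)
    }

module Automorphism {n} (σ : Aut n) where
  open Aut σ

  φ-injective : ∀ {x y} → φ x ≡ φ y → x ≡ y
  φ-injective {x} {y} eq = begin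
    x                      ≡⟨ Inverse.strictlyInverseʳ bij x ⟨
    Inverse.from bij (φ x) ≡⟨ cong (Inverse.from bij) eq ⟩
    Inverse.from bij (φ y) ≡⟨ Inverse.strictlyInverseʳ bij y ⟩
    y                      ∎
    where open ≡-Reasoning

  φ-adj : ∀ {x y} → Adj x y → Adj (φ x) (φ y)
  φ-adj {x} {y} = proj₁ (preserves x y)

  shift : Vertex n
  shift = φ (zeros n)

  π : Fin n → Fin n
  π i = proj₁ (adj⇒flipAt shift _ (φ-adj (adj-flipAt i (zeros n))))

  φ-flipAt-zeros : ∀ i → φ (flipAt i (zeros n)) ≡ flipAt (π i) shift
  φ-flipAt-zeros i = proj₂ (adj⇒flipAt shift _ (φ-adj (adj-flipAt i (zeros n))))

  π-injective : ∀ {i j} → π i ≡ π j → i ≡ j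
  π-injective {i} {j} πi≡πj = flipAt-injectiveˡ (zeros n) (φ-injective (begin
    φ (flipAt i (zeros n)) ≡⟨ φ-flipAt-zeros i ⟩
    flipAt (π i) shift     ≡⟨ cong (λ d → flipAt d shift) πi≡πj ⟩
    flipAt (π j) shift     ≡⟨ φ-flipAt-zeros j ⟨
    φ (flipAt j (zeros n)) ∎))
    where open ≡-Reasoning

  -- For r ≢ s, φ (flipAt r (flipAt s x)) is a common neighbour of the images of flipAt r x and
  -- flipAt s x other than φ x, which pins it down.
  φ-flipAt : ∀ i x → φ (flipAt i x) ≡ flipAt (π i) (φ x)
  φ-flipAt i x = flip-induction (λ x → ∀ i → φ (flipAt i x) ≡ flipAt (π i) (φ x)) φ-flipAt-zeros step x i
    where
    step : ∀ s x → (∀ i → φ (flipAt i x) ≡ flipAt (π i) (φ x)) →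
           ∀ r → φ (flipAt r (flipAt s x)) ≡ flipAt (π r) (φ (flipAt s x))
    step s x ih r with r ≟ s
    ... | yes refl = begin
      φ (flipAt r (flipAt r x))         ≡⟨ cong φ (flipAt-involutive r x) ⟩
      φ x                               ≡⟨ flipAt-involutive (π r) (φ x) ⟨
      flipAt (π r) (flipAt (π r) (φ x)) ≡⟨ cong (flipAt (π r)) (ih r) ⟨
      flipAt (π r) (φ (flipAt r x))     ∎
      where open ≡-Reasoning
    ... | no r≢s with common-neighbours (r≢s ∘ π-injective) adjʳ adjˢ
      where
      y = flipAt r (flipAt s x)
      adjʳ : Adj (flipAt (π r) (φ x)) (φ y)
      adjʳ = subst (λ z → Adj z (φ y)) (ih r)
               (φ-adj (subst (Adj (flipAt r x)) (flipAt-comm s r x) (adj-flipAt s (flipAt r x))))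
      adjˢ : Adj (flipAt (π s) (φ x)) (φ y)
      adjˢ = subst (λ z → Adj z (φ y)) (ih s) (φ-adj (adj-flipAt r (flipAt s x)))
    ...   | inj₂ φy≡ = trans φy≡ (cong (flipAt (π r)) (sym (ih s)))
    ...   | inj₁ φy≡φx = contradiction (flipAt-injectiveˡ x (begin
      flipAt r x                       ≡⟨ cong (flipAt r) (φ-injective φy≡φx) ⟨
      flipAt r (flipAt r (flipAt s x)) ≡⟨ flipAt-involutive r (flipAt s x) ⟩
      flipAt s x                       ∎)) r≢s
      where open ≡-Reasoning

  lookup-φ : ∀ x i → lookup (φ x) (π i) ≡ lookup shift (π i) xor lookup x i
  lookup-φ x i = flip-induction (λ x → ∀ i → lookup (φ x) (π i) ≡ lookup shift (π i) xor lookup x i) base step x i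
    where
    base : ∀ i → lookup shift (π i) ≡ lookup shift (π i) xor lookup (zeros n) i
    base i = sym (trans (cong (lookup shift (π i) xor_) (lookup-replicate i false)) (xor-identityʳ _))
    step : ∀ s x → (∀ i → lookup (φ x) (π i) ≡ lookup shift (π i) xor lookup x i) →
           ∀ i → lookup (φ (flipAt s x)) (π i) ≡ lookup shift (π i) xor lookup (flipAt s x) i
    step s x ih i rewrite φ-flipAt s x with s ≟ i
    ... | yes refl = begin
      lookup (flipAt (π s) (φ x)) (π s)            ≡⟨ lookup-flipAt-≡ (π s) (φ x) ⟩
      not (lookup (φ x) (π s))                     ≡⟨ cong not (ih s) ⟩
      not (lookup shift (π s) xor lookup x s)      ≡⟨ not-distribʳ-xor (lookup shift (π s)) _ ⟩
      lookup shift (π s) xor not (lookup x s)      ≡⟨ cong (lookup shift (π s) xor_) (lookup-flipAt-≡ s x) ⟨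
      lookup shift (π s) xor lookup (flipAt s x) s ∎
      where open ≡-Reasoning
    ... | no s≢i = begin
      lookup (flipAt (π s) (φ x)) (π i)            ≡⟨ lookup-flipAt-≢ (φ x) (s≢i ∘ π-injective) ⟩
      lookup (φ x) (π i)                           ≡⟨ ih i ⟩
      lookup shift (π i) xor lookup x i            ≡⟨ cong (lookup shift (π i) xor_) (lookup-flipAt-≢ x s≢i) ⟨
      lookup shift (π i) xor lookup (flipAt s x) i ∎
      where open ≡-Reasoning

  fixed-edge-off-direction : ∀ {e} → FixesEdge σ e → ∀ {t} → direction e ≢ t →
                             lookup (φ (source e)) t ≡ lookup (source e) t × lookup (φ (target e)) t ≡ lookup (source e) t
  fixed-edge-off-direction {e@((_ , _) , _)} (inj₁ (φu≡u , φv≡v)) d≢t =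
    cong (λ z → lookup z _) φu≡u , trans (cong (λ z → lookup z _) φv≡v) (target-off-direction e d≢t)
  fixed-edge-off-direction {e@((_ , _) , _)} (inj₂ (φu≡v , φv≡u)) d≢t =
    trans (cong (λ z → lookup z _) φu≡v) (target-off-direction e d≢t) , cong (λ z → lookup z _) φv≡u

  π-fixes-direction : ∀ {e} → FixesEdge σ e → π (direction e) ≡ direction e
  π-fixes-direction {e} fixes with π (direction e) ≟ direction e
  ... | yes πd≡d = πd≡d
  ... | no πd≢d = contradiction (trans (sym at-source) at-target) (not-¬ refl)
    where
    open ≡-Reasoning
    d = direction e
    u = source e
    agrees = fixed-edge-off-direction fixes (πd≢d ∘ sym)
    at-source : lookup shift (π d) xor lookup u d ≡ lookup u (π d)
    at-source = trans (sym (lookup-φ u d)) (proj₁ agrees)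
    at-target : lookup shift (π d) xor lookup u d ≡ not (lookup u (π d))
    at-target = begin
      lookup shift (π d) xor lookup u d                  ≡⟨ not-involutive _ ⟨
      not (not (lookup shift (π d) xor lookup u d))      ≡⟨ cong not (not-distribʳ-xor (lookup shift (π d)) _) ⟩
      not (lookup shift (π d) xor not (lookup u d))      ≡⟨ cong (λ b → not (lookup shift (π d) xor b)) (lookup-flipAt-≡ d u) ⟨
      not (lookup shift (π d) xor lookup (flipAt d u) d) ≡⟨ cong (λ z → not (lookup shift (π d) xor lookup z d)) (target≡flipAt e) ⟨
      not (lookup shift (π d) xor lookup (target e) d)   ≡⟨ cong not (lookup-φ (target e) d) ⟨
      not (lookup (φ (target e)) (π d))                  ≡⟨ cong not (proj₂ agrees) ⟩
      not (lookup u (π d))                               ∎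

  fixed-edge-column : ∀ {e} → FixesEdge σ e → ∀ {i} → direction e ≢ π i →
                      lookup (source e) (π i) ≡ lookup shift (π i) xor lookup (source e) i
  fixed-edge-column {e} fixes {i} d≢πi = trans (sym (proj₁ (fixed-edge-off-direction fixes d≢πi))) (lookup-φ (source e) i)

NotADirection : ∀ {n} → List (Edge n) → Fin n → Set
NotADirection T c = All (λ e → direction e ≢ c) T

Twins : ∀ {n} → List (Edge n) → Fin n → Fin n → Set
Twins T c c′ = Σ Bool λ b → All (λ e → lookup (source e) c ≡ b xor lookup (source e) c′) T

module Swap {n} {c c′ : Fin n} (c≢c′ : c ≢ c′) (b : Bool) where
  mask : Fin n → Bool
  mask = lookup (zeros n [ c ]≔ b [ c′ ]≔ b)

  mask-c : mask c ≡ b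
  mask-c = trans (lookup∘update′ c≢c′ (zeros n [ c ]≔ b) b) (lookup∘update c (zeros n) b)

  mask-c′ : mask c′ ≡ b
  mask-c′ = lookup∘update c′ (zeros n [ c ]≔ b) b

  mask-other : ∀ {t} → t ≢ c → t ≢ c′ → mask t ≡ false
  mask-other {t} t≢c t≢c′ =
    trans (lookup∘update′ t≢c′ (zeros n [ c ]≔ b) b) (trans (lookup∘update′ t≢c (zeros n) b) (lookup-replicate t false))

  τ : Fin n → Fin n
  τ = transpose c c′ ⟨$⟩ʳ_

  τ-c : τ c ≡ c′
  τ-c rewrite dec-true (c ≟ c) refl = refl

  τ-c′ : τ c′ ≡ c
  τ-c′ rewrite dec-false (c′ ≟ c) (c≢c′ ∘ sym) | dec-true (c′ ≟ c′) refl = refl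

  τ-other : ∀ {t} → t ≢ c → t ≢ c′ → τ t ≡ t
  τ-other {t} t≢c t≢c′ rewrite dec-false (t ≟ c) t≢c | dec-false (t ≟ c′) t≢c′ = refl

  swap : Aut n
  swap = relabelAut (transpose c c′) mask

  open Aut swap using (φ)

  φ-fixes : ∀ {u} → lookup u c ≡ b xor lookup u c′ → φ u ≡ u
  φ-fixes {u} u[c]≡ = lookup-ext λ t → trans (lookup-relabel mask τ u t) (pointwise t (t ≟ c) (t ≟ c′))
    where
    open ≡-Reasoning
    pointwise : ∀ t → Dec (t ≡ c) → Dec (t ≡ c′) → mask t xor lookup u (τ t) ≡ lookup u t
    pointwise t (yes refl) _ = trans (cong₂ (λ m s → m xor lookup u s) mask-c τ-c) (sym u[c]≡)
    pointwise t (no _) (yes refl) = begin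
      mask c′ xor lookup u (τ c′)       ≡⟨ cong₂ (λ m s → m xor lookup u s) mask-c′ τ-c′ ⟩
      b xor lookup u c                  ≡⟨ cong (b xor_) u[c]≡ ⟩
      b xor (b xor lookup u c′)         ≡⟨ xor-cancelˡ b _ ⟩
      lookup u c′                       ∎
    pointwise t (no t≢c) (no t≢c′) = cong₂ (λ m s → m xor lookup u s) (mask-other t≢c t≢c′) (τ-other t≢c t≢c′)

  fixes-edge : ∀ e → direction e ≢ c → direction e ≢ c′ →
               lookup (source e) c ≡ b xor lookup (source e) c′ → FixesEdge swap e
  fixes-edge e@((u , v) , _) d≢c d≢c′ u[c]≡ = inj₁ (φ-fixes u[c]≡ , (begin
    φ v                              ≡⟨ cong φ (target≡flipAt e) ⟩
    φ (flipAt (direction e) u)       ≡⟨ relabel-flipAt mask (Injection.injective (↔⇒↣ (transpose c c′))) (τ-other d≢c d≢c′) u ⟩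
    flipAt (direction e) (φ u)       ≡⟨ cong (flipAt (direction e)) (φ-fixes u[c]≡) ⟩
    flipAt (direction e) u           ≡⟨ target≡flipAt e ⟨
    v                                ∎))
    where open ≡-Reasoning

  φ-c : ∀ x → lookup (φ x) c ≡ b xor lookup x c′
  φ-c x = trans (lookup-relabel mask τ x c) (cong₂ (λ m s → m xor lookup x s) mask-c τ-c)

  -- zeros and flipAt c zeros differ at c but have images agreeing at c.
  nontrivial : ¬ (∀ x → φ x ≡ x)
  nontrivial φ≗id = contradiction (begin
    false                                ≡⟨ lookup-replicate c false ⟨
    lookup (zeros n) c                   ≡⟨ fixed-bit (zeros n) ⟨
    lookup (φ (zeros n)) c               ≡⟨ φ-c (zeros n) ⟩
    b xor lookup (zeros n) c′            ≡⟨ cong (b xor_) (lookup-flipAt-≢ (zeros n) c≢c′) ⟨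
    b xor lookup (flipAt c (zeros n)) c′ ≡⟨ φ-c (flipAt c (zeros n)) ⟨
    lookup (φ (flipAt c (zeros n))) c    ≡⟨ fixed-bit (flipAt c (zeros n)) ⟩
    lookup (flipAt c (zeros n)) c        ≡⟨ lookup-flipAt-≡ c (zeros n) ⟩
    not (lookup (zeros n) c)             ≡⟨ cong not (lookup-replicate c false) ⟩
    true                                 ∎) λ ()
    where
    open ≡-Reasoning
    fixed-bit : ∀ x → lookup (φ x) c ≡ lookup x c
    fixed-bit x = cong (λ z → lookup z c) (φ≗id x)

twins⇒¬determining : ∀ {n} {T : List (Edge n)} {c c′} → c ≢ c′ →
                     NotADirection T c → NotADirection T c′ → Twins T c c′ → ¬ EdgeDetermining T
twins⇒¬determining c≢c′ free free′ (b , twins) determining =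
  Swap.nontrivial c≢c′ b (determining (Swap.swap c≢c′ b) (All.zipWith fixes (All.zip (free , free′) , twins)))
  where
  fixes : ∀ {e} → ((direction e ≢ _ × direction e ≢ _) × _) → FixesEdge (Swap.swap c≢c′ b) e
  fixes {e} ((d≢c , d≢c′) , twin) = Swap.fixes-edge c≢c′ b e d≢c d≢c′ twin

-- π fixes every direction, so for a non-direction i the coordinates π i and i are twins, forcing
-- π = id; an edge whose direction is not c then forces bit c of shift to vanish.
no-twins⇒determining : ∀ {n} (T : List (Edge n)) →
                       (∀ c → Any (λ e → direction e ≢ c) T) →
                       (∀ {c c′} → NotADirection T c → NotADirection T c′ → Twins T c c′ → c ≡ c′) →
                       EdgeDetermining T
no-twins⇒determining T spread no-twins σ fixes x = lookup-ext φx≗x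
  where
  open Aut σ using (φ)
  open Automorphism σ
  open ≡-Reasoning

  π-preserves-NotADirection : ∀ {i} → NotADirection T i → NotADirection T (π i)
  π-preserves-NotADirection free = All.zipWith
    (λ (fix , d≢i) d≡πi → d≢i (π-injective (trans (π-fixes-direction fix) d≡πi))) (fixes , free)

  π≗id : ∀ i → π i ≡ i
  π≗id i with any? (λ e → direction e ≟ i) T
  ... | yes is-direction =
    let fix , d≡i = All.lookupAny fixes is-direction in subst (λ j → π j ≡ j) d≡i (π-fixes-direction fix)
  ... | no ¬is-direction = no-twins (π-preserves-NotADirection free) free
          (lookup shift (π i) , All.zipWith (λ (fix , d≢πi) → fixed-edge-column fix d≢πi)
                                            (fixes , π-preserves-NotADirection free))
    where
    free : NotADirection T i
    free = ¬Any⇒All¬ T ¬is-direction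

  shift-bit : ∀ c → lookup shift c ≡ false
  shift-bit c with All.lookupAny fixes (spread c)
  ... | fix , d≢c = ≡xor⇒false (lookup shift c) (begin
    lookup (source e) c                        ≡⟨ cong (lookup (source e)) (π≗id c) ⟨
    lookup (source e) (π c)                    ≡⟨ fixed-edge-column {e} fix {c} (subst (direction e ≢_) (sym (π≗id c)) d≢c) ⟩
    lookup shift (π c) xor lookup (source e) c ≡⟨ cong (λ j → lookup shift j xor lookup (source e) c) (π≗id c) ⟩
    lookup shift c xor lookup (source e) c     ∎)
    where
    e = Any.lookup (spread c)

  φx≗x : ∀ t → lookup (φ x) t ≡ lookup x t
  φx≗x t = begin
    lookup (φ x) t                     ≡⟨ cong (lookup (φ x)) (π≗id t) ⟨
    lookup (φ x) (π t)                 ≡⟨ lookup-φ x t ⟩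
    lookup shift (π t) xor lookup x t  ≡⟨ cong (_xor lookup x t) (shift-bit (π t)) ⟩
    lookup x t                         ∎

-- Normalising column c by its first entry identifies twins; 2 ^ (|T| - 1) codes remain.
columnCode : ∀ {n} (T : List (Edge n)) → Fin n → Fin (2 ^ (length T ∸ 1))
columnCode [] c = zero
columnCode (e₀ ∷ T) c = fromBits λ i → lookup (source e₀) c xor lookup (source (List.lookup T i)) c

columnCode-injective-upto-twins : ∀ {n} (T : List (Edge n)) {c c′} → columnCode T c ≡ columnCode T c′ → Twins T c c′
columnCode-injective-upto-twins [] _ = false , []
columnCode-injective-upto-twins (e₀ ∷ T) {c} {c′} eq =
  x₀ xor y₀ , xor-≡⇒≡xor x₀ y₀ (trans (xor-same x₀) (sym (xor-same y₀)))
            ∷ All-from-lookup T (xor-≡⇒≡xor x₀ y₀ ∘ fromBits-injective eq)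
  where
  x₀ = lookup (source e₀) c
  y₀ = lookup (source e₀) c′

signature : ∀ {n} (T : List (Edge n)) → Fin n → Fin (length T) ⊎ Fin (2 ^ (length T ∸ 1))
signature T c with any? (λ e → direction e ≟ c) T
... | yes is-direction = inj₁ (Any.index is-direction)
... | no _ = inj₂ (columnCode T c)

signature-collision⇒¬determining : ∀ {n} {T : List (Edge n)} {c c′} → c ≢ c′ →
                                   signature T c ≡ signature T c′ → ¬ EdgeDetermining T
signature-collision⇒¬determining {T = T} {c} {c′} c≢c′ eq
  with any? (λ e → direction e ≟ c) T | any? (λ e → direction e ≟ c′) T
... | yes is-dir | yes is-dir′ = λ _ → c≢c′ (begin
  c                                          ≡⟨ lookup-index is-dir ⟨
  direction (List.lookup T (Any.index is-dir))  ≡⟨ cong (direction ∘ List.lookup T) (inj₁-injective eq) ⟩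
  direction (List.lookup T (Any.index is-dir′)) ≡⟨ lookup-index is-dir′ ⟩
  c′                                         ∎)
  where open ≡-Reasoning
... | yes _ | no _ = contradiction eq λ ()
... | no _ | yes _ = contradiction eq λ ()
... | no ¬dir | no ¬dir′ =
  twins⇒¬determining c≢c′ (¬Any⇒All¬ T ¬dir) (¬Any⇒All¬ T ¬dir′) (columnCode-injective-upto-twins T (inj₂-injective eq))

-- For m ≥ 2, the largest n for which m edges can determine Q_n.
capacity : ℕ → ℕ
capacity m = m + 2 ^ (m ∸ 1)

capacity<n⇒¬determining : ∀ {n} (T : List (Edge n)) → capacity (length T) < n → ¬ EdgeDetermining T
capacity<n⇒¬determining {n} T capacity<n with pigeonhole capacity<n (join _ _ ∘ signature T)
... | i , j , i<j , eq = signature-collision⇒¬determining (<⇒≢ i<j) (begin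
  signature T i                        ≡⟨ splitAt-join _ _ (signature T i) ⟨
  splitAt _ (join _ _ (signature T i)) ≡⟨ cong (splitAt _) eq ⟩
  splitAt _ (join _ _ (signature T j)) ≡⟨ splitAt-join _ _ (signature T j) ⟩
  signature T j                        ∎)
  where open ≡-Reasoning

-- Edge j starts at a vertex vanishing on the direction coordinates; row 0 vanishes everywhere, which
-- rules out complementary twins, and row i + 1 carries bit i of the code of each other coordinate.
module Construction {n k : ℕ} (2+k≤n : 2 + k ≤ n) (n≤capacity : n ≤ capacity (2 + k)) where
  part : Fin n → Fin (2 + k) ⊎ Fin (2 ^ suc k)
  part c = splitAt (2 + k) (inject≤ c n≤capacity)

  part-injective : ∀ {c c′} → part c ≡ part c′ → c ≡ c′
  part-injective {c} {c′} eq = inject≤-injective n≤capacity n≤capacity c c′ (begin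
    inject≤ c n≤capacity     ≡⟨ join-splitAt (2 + k) _ _ ⟨
    join (2 + k) _ (part c)  ≡⟨ cong (join (2 + k) _) eq ⟩
    join (2 + k) _ (part c′) ≡⟨ join-splitAt (2 + k) _ _ ⟩
    inject≤ c′ n≤capacity    ∎)
    where open ≡-Reasoning

  dir : Fin (2 + k) → Fin n
  dir j = inject≤ j 2+k≤n

  part-dir : ∀ j → part (dir j) ≡ inj₁ j
  part-dir j = trans (cong (splitAt (2 + k)) (toℕ-injective toℕ-equal)) (splitAt-↑ˡ (2 + k) j _)
    where
    toℕ-equal : toℕ (inject≤ (dir j) n≤capacity) ≡ toℕ (j ↑ˡ 2 ^ suc k)
    toℕ-equal = trans (toℕ-inject≤ (dir j) n≤capacity) (trans (toℕ-inject≤ j 2+k≤n) (sym (toℕ-↑ˡ j _)))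

  dir-injective : ∀ {i j} → dir i ≡ dir j → i ≡ j
  dir-injective {i} {j} eq = inj₁-injective (trans (sym (part-dir i)) (trans (cong part eq) (part-dir j)))

  row : Fin (2 + k) → Fin (2 ^ suc k) → Bool
  row zero code = false
  row (suc i) code = toBits code i

  vertex : Fin (2 + k) → Vertex n
  vertex j = tabulate (λ c → [ (λ _ → false) , row j ]′ (part c))

  edge : Fin (2 + k) → Edge n
  edge j = edgeAt (vertex j) (dir j)

  edges : List (Edge n)
  edges = List.tabulate edge

  length-edges : length edges ≡ 2 + k
  length-edges = length-tabulate edge

  direction-edge : ∀ j → direction (edge j) ≡ dir j
  direction-edge j = direction-edgeAt (vertex j) (dir j)

  spread : ∀ c → Any (λ e → direction e ≢ c) edges
  spread c with dir zero ≟ c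
  ... | yes refl = Any.tabulate⁺ {f = edge} (suc zero) λ d≡ → case dir-injective (trans (sym (direction-edge (suc zero))) d≡) of λ ()
  ... | no d₀≢c = Any.tabulate⁺ {f = edge} zero (λ d≡ → d₀≢c (trans (sym (direction-edge zero)) d≡))

  lookup-vertex : ∀ j c → lookup (vertex j) c ≡ [ (λ _ → false) , row j ]′ (part c)
  lookup-vertex j c = lookup∘tabulate _ c

  code : ∀ {c} → NotADirection edges c → Σ (Fin (2 ^ suc k)) λ x → part c ≡ inj₂ x
  code {c} free with part c in part-c
  ... | inj₁ j = contradiction (trans (direction-edge j) (part-injective (trans (part-dir j) (sym part-c))))
                               (All.tabulate⁻ {f = edge} free j)
  ... | inj₂ x = x , refl

  no-twins : ∀ {c c′} → NotADirection edges c → NotADirection edges c′ → Twins edges c c′ → c ≡ c′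
  no-twins {c} {c′} free free′ (b , twins) with code free | code free′
  ... | x , part-c | x′ , part-c′ = part-injective (trans part-c (trans (cong inj₂ x≡x′) (sym part-c′)))
    where
    open ≡-Reasoning
    rows : ∀ j → row j x ≡ b xor row j x′
    rows j = begin
      row j x                                        ≡⟨ cong [ (λ _ → false) , row j ]′ part-c ⟨
      [ (λ _ → false) , row j ]′ (part c)            ≡⟨ lookup-vertex j c ⟨
      lookup (vertex j) c                            ≡⟨ All.tabulate⁻ {f = edge} twins j ⟩
      b xor lookup (vertex j) c′                     ≡⟨ cong (b xor_) (lookup-vertex j c′) ⟩
      b xor [ (λ _ → false) , row j ]′ (part c′)     ≡⟨ cong (λ p → b xor [ (λ _ → false) , row j ]′ p) part-c′ ⟩
      b xor row j x′                                 ∎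
    b≡false : b ≡ false
    b≡false = sym (trans (rows zero) (xor-identityʳ b))
    x≡x′ : x ≡ x′
    x≡x′ = toBits-injective λ i → trans (rows (suc i)) (cong (_xor row (suc i) x′) b≡false)

n<2^n : ∀ n → n < 2 ^ n
n<2^n zero = s≤s z≤n
n<2^n (suc n) = +-mono-≤ (m^n>0 2 n) (≤-trans (n<2^n n) (m≤m+n (2 ^ n) 0))

capacity≤2^ : ∀ m → capacity m ≤ 2 ^ m
capacity≤2^ zero = ≤-refl
capacity≤2^ (suc m) = +-mono-≤ (n<2^n m) (m≤m+n (2 ^ m) 0)

capacity-mono : ∀ {j m} → j ≤ m → capacity j ≤ capacity m
capacity-mono j≤m = +-mono-≤ j≤m (^-monoʳ-≤ 2 (∸-monoˡ-≤ 1 j≤m))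

m<capacity : ∀ m → m < capacity m
m<capacity m = subst (_< capacity m) (+-identityʳ m) (+-monoʳ-< m (m^n>0 2 (m ∸ 1)))

detPrime≡-capacity : ∀ {n m} → 2 ≤ m → capacity (m ∸ 1) < n → n ≤ capacity m → DetPrime≡ n m
detPrime≡-capacity {m = m@(suc (suc k))} (s≤s (s≤s z≤n)) capacity<n n≤capacity =
  (edges , no-twins⇒determining edges spread no-twins , length-edges) , minimal
  where
  open Construction (<⇒≤ (≤-<-trans (m<capacity (suc k)) capacity<n)) n≤capacity
  minimal : ∀ T → EdgeDetermining T → m ≤ length T
  minimal T determining with m ≤? length T
  ... | yes m≤|T| = m≤|T|
  ... | no m≰|T| = contradiction determining
        (capacity<n⇒¬determining T (≤-<-trans (capacity-mono (pred-mono-≤ (≰⇒> m≰|T|))) capacity<n))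

corollary3 : (n : ℕ) → 3 ≤ n →
    (2 ^ (⌈log₂ n ⌉ ∸ 1) < n → n ≤ 2 ^ (⌈log₂ n ⌉ ∸ 1) + ⌈log₂ n ⌉ → DetPrime≡ n ⌈log₂ n ⌉)
    × (2 ^ (⌈log₂ n ⌉ ∸ 1) + ⌈log₂ n ⌉ < n → n ≤ 2 ^ ⌈log₂ n ⌉ → DetPrime≡ n (⌈log₂ n ⌉ + 1))
corollary3 n 3≤n = small-excess , large-excess
  where
  k = ⌈log₂ n ⌉
  2≤k : 2 ≤ k
  2≤k = ⌈log₂⌉-mono-≤ 3≤n
  k+1∸1≡k : k + 1 ∸ 1 ≡ k
  k+1∸1≡k = m+n∸n≡m k 1

  small-excess : 2 ^ (k ∸ 1) < n → n ≤ 2 ^ (k ∸ 1) + k → DetPrime≡ n k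
  small-excess 2^[k-1]<n n≤2^[k-1]+k = detPrime≡-capacity 2≤k
    (≤-<-trans (capacity≤2^ (k ∸ 1)) 2^[k-1]<n)
    (≤-trans n≤2^[k-1]+k (≤-reflexive (+-comm (2 ^ (k ∸ 1)) k)))

  large-excess : 2 ^ (k ∸ 1) + k < n → n ≤ 2 ^ k → DetPrime≡ n (k + 1)
  large-excess 2^[k-1]+k<n n≤2^k = detPrime≡-capacity (≤-trans 2≤k (m≤m+n k 1))
    (subst (λ j → capacity j < n) (sym k+1∸1≡k) (subst (_< n) (+-comm (2 ^ (k ∸ 1)) k) 2^[k-1]+k<n))
    (≤-trans n≤2^k (subst (λ j → 2 ^ k ≤ k + 1 + 2 ^ j) (sym k+1∸1≡k) (m≤n+m (2 ^ k) (k + 1))))
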